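{- Let $n,k$ be positive integers with $n\ge 2k$, and let $G$ be a graph belonging to the Johnson scheme $J(n,k)$. If the Grover walk on $G$ exhibits perfect state transfer, then $n=2k$. Moreover, in $J(2k,k)$ the class $A_k$ is a permutation matrix of order $2$ with no fixed points.
   Context: For $0\le i\le k-1$, the generalized Johnson graph $J(n,k,i)$ has as vertices the $k$-subsets of $\{1,\dots,n\}$, two being adjacent iff their intersection has size $i$. The Johnson scheme $J(n,k)$ is $\{A_0,\dots,A_k\}$ with $A_0=I$ and $A_i$ the adjacency matrix of $J(n,k,k-i)$ for $1\le i\le k$; it is an association scheme, and a graph belongs to it if its adjacency matrix lies in $\operatorname{span}\{A_0,\dots,A_k\}$. Grover walk: for a finite simple graph $G$ without isolated vertices, arcs $\mathcal{A}(G)=\{(u,v),(v,u):uv\in E(G)\}$, $t((u,v))=v$, $(u,v)^{ -1}=(v,u)$; shift $S_{ab}=\delta_{a,b^{ -1}}$; boundary $N_{ua}=\frac{1}{\sqrt{\deg u}}\delta_{u,t(a)}$; $U=S(2N^*N-I)$; $\Phi_u=N^*\mathbf{e}_u$. $G$ exhibits perfect state transfer if there are vertices $u\ne v$, a positive integer $\tau$ and a unimodular $\gamma$ with $U^\tau\Phi_u=\gamma\Phi_v$. -}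

module Defs where

open import Data.Bool using (Bool; true; false; if_then_else_; _∧_)
import Data.Bool.Properties as BoolP
open import Data.Nat as ℕ using (ℕ; zero; suc; _≤_)
open import Data.Fin using (Fin)
open import Data.Fin.Subset using (Subset; ∣_∣; _∩_; inside; outside)
open import Data.Vec using (Vec; []; _∷_)
import Data.Vec.Properties as VecP
open import Data.List using (List; []; _∷_; map; filter; length; concatMap; foldr)
open import Data.Integer using (+_)
open import Data.Rational as ℚ using (ℚ; 0ℚ; 1ℚ; _+_; _*_; _-_)
open import Data.Product using (Σ; ∃; _×_; _,_; proj₁; proj₂)
open import Relation.Nullary using (¬_; Dec; yes; no; does)
open import Relation.Binary.PropositionalEquality using (_≡_)
import Data.Sum
import Data.List
open import Relation.Nullary.Decidable using (⌊_⌋)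
open import Data.List.Membership.Propositional using (_∈_)

Σ[_]_ : ∀ {A : Set} → List A → (A → ℚ) → ℚ
Σ[ xs ] f = foldr (λ x acc → f x + acc) 0ℚ xs

ΣN[_]_ : ∀ {A : Set} → List A → (A → ℕ) → ℕ
ΣN[ xs ] f = foldr (λ x acc → f x ℕ.+ acc) 0 xs

toℚ : ℕ → ℚ
toℚ m = (+ m) ℚ./ 1

bℚ : Bool → ℚ
bℚ true  = 1ℚ
bℚ false = 0ℚ

bℕ : Bool → ℕ
bℕ true  = 1
bℕ false = 0

-- 1/d for d ≥ 1 (and 0 for d = 0; only used for degrees, which are ≥ 1
-- under the no-isolated-vertices hypothesis)
inv : ℕ → ℚ
inv zero    = 0ℚ
inv (suc d) = (+ 1) ℚ./ suc d

_≟ₛ_ : ∀ {n} (x y : Subset n) → Dec (x ≡ y)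
_≟ₛ_ = VecP.≡-dec BoolP._≟_

_==ₛ_ : ∀ {n} → Subset n → Subset n → Bool
x ==ₛ y = ⌊ x ≟ₛ y ⌋

allSubsets : (n : ℕ) → List (Subset n)
allSubsets zero    = [] ∷ []
allSubsets (suc n) = map (outside ∷_) (allSubsets n) Data.List.++ map (inside ∷_) (allSubsets n)

verts : (n k : ℕ) → List (Subset n)
verts n k = filter (λ x → ∣ x ∣ ℕ.≟ k) (allSubsets n)

IsVertex : (n k : ℕ) → Subset n → Set
IsVertex n k x = ∣ x ∣ ≡ k

-- The Johnson scheme J(n,k) = {A_0,…,A_k}:  A_i x y = 1 iff |x ∩ y| = k - i
-- (A_0 = I, A_i = adjacency matrix of J(n,k,k-i)).

Aᴶ : (n k : ℕ) → Fin (suc k) → Subset n → Subset n → Bool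
Aᴶ n k i x y = ⌊ ∣ x ∩ y ∣ ℕ.+ Data.Fin.toℕ i ℕ.≟ k ⌋

record Graph (n k : ℕ) : Set where
  field
    adj   : Subset n → Subset n → Bool
    sym   : ∀ x y → IsVertex n k x → IsVertex n k y → adj x y ≡ adj y x
    loopless : ∀ x → IsVertex n k x → adj x x ≡ false
open Graph public

BelongsToScheme : ∀ {n k} → Graph n k → Set
BelongsToScheme {n} {k} G =
  Σ (Fin (suc k) → ℚ) λ c →
    ∀ x y → IsVertex n k x → IsVertex n k y →
      bℚ (adj G x y) ≡ Σ[ Data.List.allFin (suc k) ] (λ i → c i * bℚ (Aᴶ n k i x y))

deg : ∀ {n k} → Graph n k → Subset n → ℕ
deg {n} {k} G x = length (filter (λ y → adj G x y BoolP.≟ true) (verts n k))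

NoIsolatedVertices : ∀ {n k} → Graph n k → Set
NoIsolatedVertices {n} {k} G = ∀ x → IsVertex n k x → 1 ≤ deg G x

Arc : ℕ → Set
Arc n = Subset n × Subset n      -- (u , v), tail u, head v

IsArc : ∀ {n k} → Graph n k → Arc n → Set
IsArc {n} {k} G (u , v) = IsVertex n k u × IsVertex n k v × adj G u v ≡ true

arcs : ∀ {n k} → Graph n k → List (Arc n)
arcs {n} {k} G =
  filter (λ a → adj G (proj₁ a) (proj₂ a) BoolP.≟ true)
    (concatMap (λ u → map (u ,_) (verts n k)) (verts n k))

t : ∀ {n} → Arc n → Subset n
t (u , v) = v

_⁻¹ : ∀ {n} → Arc n → Arc n
(u , v) ⁻¹ = (v , u)

-- vectors indexed by arcs (only values on arcs of G matter)
ArcVec : ℕ → Set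
ArcVec n = Arc n → ℚ

shift : ∀ {n k} → Graph n k → ArcVec n → ArcVec n
shift G ψ a = Σ[ arcs G ] (λ b → bℚ (a ==ₐ (b ⁻¹)) * ψ b)
  where
  _==ₐ_ : _ → _ → Bool
  (x , y) ==ₐ (x' , y') = (x ==ₛ x') ∧ (y ==ₛ y')

-- (N* N)_{ab} = Σ_u N_{ua} N_{ub} = (1/deg u) [t a = u = t b]
NstarN : ∀ {n k} → Graph n k → ArcVec n → ArcVec n
NstarN {n} {k} G ψ a =
  Σ[ arcs G ] (λ b → Σ[ verts n k ] (λ u →
     inv (deg G u) * bℚ (u ==ₛ t a) * bℚ (u ==ₛ t b)) * ψ b)

coin : ∀ {n k} → Graph n k → ArcVec n → ArcVec n
coin G ψ a = toℚ 2 * NstarN G ψ a - ψ a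

U : ∀ {n k} → Graph n k → ArcVec n → ArcVec n
U G ψ = shift G (coin G ψ)

Uᵗ : ∀ {n k} → Graph n k → ℕ → ArcVec n → ArcVec n
Uᵗ G zero    ψ = ψ
Uᵗ G (suc τ) ψ = U G (Uᵗ G τ ψ)

-- √(deg u) · Φ_u = √(deg u) · N* e_u : the indicator of arcs with head u
χ : ∀ {n} → Subset n → ArcVec n
χ u a = bℚ (u ==ₛ t a)

-- Perfect state transfer, stated for the rescaled vectors χ_u = √(deg u) Φ_u:
--   U^τ Φ_u = γ Φ_v   ⇔   U^τ χ_u = q χ_v  with  q = γ √(deg u / deg v),
-- |γ| = 1  ⇔  q² · deg v = deg u.  Since U and χ are rational, q is
-- rational.
PST : ∀ {n k} → Graph n k → Set
PST {n} {k} G =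
  Σ (Subset n) λ u → Σ (Subset n) λ v →
    IsVertex n k u × IsVertex n k v × ¬ (u ≡ v) ×
    Σ ℕ λ τ → 1 ≤ τ × Σ ℚ λ q →
      (q * q * toℚ (deg G v) ≡ toℚ (deg G u)) ×
      (∀ a → IsArc G a → Uᵗ G τ (χ u) a ≡ q * χ v a)

Mat : ℕ → Set
Mat n = Subset n → Subset n → ℕ

_·ₘ_ : ∀ {n} → (k : ℕ) → Mat n → Mat n → Mat n
_·ₘ_ {n} k M M' x z = ΣN[ verts n k ] (λ y → M x y ℕ.* M' y z)

IsPermutationMatrix : (n k : ℕ) → Mat n → Set
IsPermutationMatrix n k M =
  (∀ x y → IsVertex n k x → IsVertex n k y → (M x y ≡ 0 Data.Sum.⊎ M x y ≡ 1)) ×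
  (∀ x → IsVertex n k x → ΣN[ verts n k ] (λ y → M x y) ≡ 1) ×
  (∀ y → IsVertex n k y → ΣN[ verts n k ] (λ x → M x y) ≡ 1)

IdM : ∀ {n} → Mat n
IdM x y = bℕ (x ==ₛ y)

IsFixedPointFreeInvolution : (n k : ℕ) → Mat n → Set
IsFixedPointFreeInvolution n k M =
  IsPermutationMatrix n k M ×
  (∀ x z → IsVertex n k x → IsVertex n k z → (k ·ₘ M) M x z ≡ IdM x z) ×
  (¬ (∀ x y → IsVertex n k x → IsVertex n k y → M x y ≡ IdM x y)) ×
  (∀ x → IsVertex n k x → M x x ≡ 0)

Aᴶℕ : (n k : ℕ) → Fin (suc k) → Mat n
Aᴶℕ n k i x y = bℕ (Aᴶ n k i x y)

{-# OPTIONS --safe #-}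
module Submission where

-- Every permutation of the ground set {1,…,n} acts on k-subsets preserving all
-- intersection sizes, so it is an automorphism of every graph of the Johnson
-- scheme, and the Grover walk commutes with the induced permutation of arcs.
-- Suppose n > 2k and U^τ χ_u = q χ_v.  Pick a ∈ v ∖ u and b ∉ u ∪ v: the
-- transposition (a b) fixes u but moves v, so U^τ χ_u is invariant under it
-- while q χ_v is not unless q = 0; then deg u = q² deg v = 0.  For n = 2k two
-- k-subsets are disjoint iff they are complementary, so A_k is the permutation
-- matrix of complementation, a fixed-point-free involution.

open import Defs
open import Data.Nat using (ℕ; _≤_; _*_)
open import Data.Fin using (fromℕ)
open import Data.Product using (_×_)
open import Relation.Binary.PropositionalEquality using (_≡_)

import Algebra.Properties.CommutativeMonoid.Sum as CommutativeMonoidSum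
open import Data.Bool using (true; false; not; _∧_)
import Data.Bool.Properties as Boolₚ
open import Data.Empty using (⊥; ⊥-elim)
open import Data.Fin as Fin using (toℕ)
import Data.Fin.Properties as Finₚ
open import Data.Fin.Permutation using (Permutation; _⟨$⟩ʳ_; flip; transpose; inverseˡ)
import Data.Fin.Permutation.Components as PC
open import Data.Fin.Subset using (Subset; ∣_∣; _∩_; ∁; ⊤; inside; outside) renaming (⊥ to ∅)
import Data.Fin.Subset.Properties as Subsetₚ
import Data.Integer as ℤ
open import Data.Integer.GCD using (gcd)
import Data.Integer.Properties as ℤₚ
open import Data.List
  using (List; []; _∷_; _++_; map; filter; length; concatMap; cartesianProduct; foldr; allFin)
open import Data.List.Properties using (foldr-map; foldr-cong; length-map)
open import Data.List.Membership.Propositional using (_∈_)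
import Data.List.Membership.Propositional.Properties as ∈ₚ
open import Data.List.Membership.Propositional.Properties.WithK using (unique∧set⇒bag)
open import Data.List.Relation.Unary.Any using (here; there)
import Data.List.Relation.Unary.All as All
open import Data.List.Relation.Unary.Unique.Propositional using (Unique; []; _∷_)
import Data.List.Relation.Unary.Unique.Propositional.Properties as Uniqueₚ
open import Data.List.Relation.Binary.BagAndSetEquality using (∼bag⇒↭)
open import Data.List.Relation.Binary.Permutation.Propositional using (_↭_; ↭⇒↭ₛ)
import Data.List.Relation.Binary.Permutation.Propositional.Properties as ↭ₚ
import Data.List.Relation.Binary.Permutation.Setoid.Properties as ↭ₛₚ
import Data.Nat as ℕ
open import Data.Nat using (zero; suc; _<_)
import Data.Nat.Properties as ℕₚ
import Data.Rational as ℚ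
open import Data.Rational using (ℚ; 0ℚ)
import Data.Rational.Properties as ℚₚ
open import Data.Product as Product using (∃; _,_; proj₁; proj₂)
open import Data.Sum using (_⊎_; inj₁; inj₂)
open import Data.Vec as Vec using (Vec; []; _∷_; lookup; tabulate)
import Data.Vec.Properties as Vecₚ
open import Function using (_∘_; id; _⇔_; mk⇔)
open import Relation.Nullary using (¬_; Dec; yes; no)
open import Relation.Nullary.Decidable using (⌊_⌋; isYes≗does; dec-true; dec-false; does-⇔)
import Relation.Binary.PropositionalEquality as ≡
open import Relation.Binary.PropositionalEquality
  using (_≢_; _≗_; refl; trans; cong; cong₂; subst; subst₂; setoid; module ≡-Reasoning)

open ≡-Reasoning
open CommutativeMonoidSum ℕₚ.+-0-commutativeMonoid using (sum; sum-permute; sum-cong-≗)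

⌊⌋-⇔ : ∀ {A B : Set} → A ⇔ B → (a? : Dec A) (b? : Dec B) → ⌊ a? ⌋ ≡ ⌊ b? ⌋
⌊⌋-⇔ A⇔B a? b? = trans (isYes≗does a?) (trans (does-⇔ A⇔B a? b?) (≡.sym (isYes≗does b?)))

==ₛ-true : ∀ {n} {x y : Subset n} → x ≡ y → (x ==ₛ y) ≡ true
==ₛ-true {x = x} {y} x≡y = trans (isYes≗does (x ≟ₛ y)) (dec-true (x ≟ₛ y) x≡y)

==ₛ-false : ∀ {n} {x y : Subset n} → x ≢ y → (x ==ₛ y) ≡ false
==ₛ-false {x = x} {y} x≢y = trans (isYes≗does (x ≟ₛ y)) (dec-false (x ≟ₛ y) x≢y)

injective⇒==ₛ-preserved : ∀ {m n} {f : Subset m → Subset n} → (∀ {x y} → f x ≡ f y → x ≡ y) →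
                          ∀ x y → (f x ==ₛ f y) ≡ (x ==ₛ y)
injective⇒==ₛ-preserved {f = f} f-injective x y =
  ⌊⌋-⇔ (mk⇔ f-injective (cong f)) (f x ≟ₛ f y) (x ≟ₛ y)

bℚ-injective : ∀ {b c} → bℚ b ≡ bℚ c → b ≡ c
bℚ-injective {true}  {true}  _ = refl
bℚ-injective {false} {false} _ = refl
bℚ-injective {true}  {false} ()
bℚ-injective {false} {true}  ()

bℕ-0∨1 : ∀ b → bℕ b ≡ 0 ⊎ bℕ b ≡ 1
bℕ-0∨1 true  = inj₂ refl
bℕ-0∨1 false = inj₁ refl

toℚ≡0⇒≡0 : ∀ m → toℚ m ≡ 0ℚ → m ≡ 0
toℚ≡0⇒≡0 m toℚm≡0 = ℤₚ.+-injective (begin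
  ℤ.+ m              ≡⟨ ℚₚ.↥-/ (ℤ.+ m) 1 ⟨
  ℚ.↥ (toℚ m) ℤ.* g  ≡⟨ cong (λ r → ℚ.↥ r ℤ.* g) toℚm≡0 ⟩
  ℤ.+ 0 ℤ.* g        ≡⟨ ℤₚ.*-zeroˡ g ⟩
  ℤ.+ 0              ∎)
  where g = gcd (ℤ.+ m) (ℤ.+ 1)

n+n≡2*n : ∀ n → n ℕ.+ n ≡ 2 * n
n+n≡2*n n = cong (n ℕ.+_) (≡.sym (ℕₚ.+-identityʳ n))

map-↭ : ∀ {A B : Set} {f : A → B} {g : B → A} {xs ys} →
        (∀ x → g (f x) ≡ x) → (∀ y → f (g y) ≡ y) → Unique xs → Unique ys →
        (∀ {x} → x ∈ xs → f x ∈ ys) → (∀ {y} → y ∈ ys → g y ∈ xs) → map f xs ↭ ys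
map-↭ {f = f} {g} {xs} {ys} g∘f≗id f∘g≗id xs! ys! f∈ g∈ =
  ∼bag⇒↭ (unique∧set⇒bag (Uniqueₚ.map⁺ f-injective xs!) ys! (mk⇔ to from))
  where
  f-injective : ∀ {x x′} → f x ≡ f x′ → x ≡ x′
  f-injective {x} {x′} fx≡fx′ = trans (≡.sym (g∘f≗id x)) (trans (cong g fx≡fx′) (g∘f≗id x′))
  to : ∀ {y} → y ∈ map f xs → y ∈ ys
  to y∈ with _ , x∈ , refl ← ∈ₚ.∈-map⁻ f y∈ = f∈ x∈
  from : ∀ {y} → y ∈ ys → y ∈ map f xs
  from {y} y∈ = subst (_∈ map f xs) (f∘g≗id y) (∈ₚ.∈-map⁺ f (g∈ y∈))

∈-nonempty : ∀ {A : Set} (xs : List A) → 1 ≤ length xs → ∃ (_∈ xs)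
∈-nonempty (x ∷ _) _ = x , here refl

concatMap-pairs≡cartesianProduct : ∀ {A B : Set} (xs : List A) (ys : List B) →
                                   concatMap (λ x → map (x ,_) ys) xs ≡ cartesianProduct xs ys
concatMap-pairs≡cartesianProduct []       ys = refl
concatMap-pairs≡cartesianProduct (x ∷ xs) ys =
  cong (map (x ,_) ys ++_) (concatMap-pairs≡cartesianProduct xs ys)

Σ-cong : ∀ {A : Set} (xs : List A) {f g : A → ℚ} → f ≗ g → Σ[ xs ] f ≡ Σ[ xs ] g
Σ-cong xs f≗g = foldr-cong (λ x acc → cong (ℚ._+ acc) (f≗g x)) refl xs

Σ-cong-∈ : ∀ {A : Set} (xs : List A) {f g : A → ℚ} → (∀ {x} → x ∈ xs → f x ≡ g x) →
           Σ[ xs ] f ≡ Σ[ xs ] g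
Σ-cong-∈ []       _   = refl
Σ-cong-∈ (x ∷ xs) f≗g = cong₂ ℚ._+_ (f≗g (here refl)) (Σ-cong-∈ xs (f≗g ∘ there))

Σ-↭ : ∀ {A : Set} {xs ys : List A} → xs ↭ ys → (f : A → ℚ) → Σ[ xs ] f ≡ Σ[ ys ] f
Σ-↭ {xs = xs} {ys} xs↭ys f = begin
  Σ[ xs ] f                   ≡⟨ foldr-map ℚ._+_ f 0ℚ xs ⟨
  foldr ℚ._+_ 0ℚ (map f xs)   ≡⟨ ↭ₛₚ.foldr-commMonoid (setoid ℚ) ℚₚ.+-0-isCommutativeMonoid
                                   (↭⇒↭ₛ (↭ₚ.map⁺ f xs↭ys)) ⟩
  foldr ℚ._+_ 0ℚ (map f ys)   ≡⟨ foldr-map ℚ._+_ f 0ℚ ys ⟩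
  Σ[ ys ] f                   ∎

Σ-reindex : ∀ {A : Set} {xs : List A} {σ : A → A} → map σ xs ↭ xs → (f : A → ℚ) →
            Σ[ xs ] f ≡ Σ[ xs ] (f ∘ σ)
Σ-reindex {xs = xs} {σ} σxs↭xs f = trans (≡.sym (Σ-↭ σxs↭xs f)) (foldr-map _ σ 0ℚ xs)

ΣN-zero : ∀ {A : Set} (xs : List A) {f : A → ℕ} → (∀ {x} → x ∈ xs → f x ≡ 0) → ΣN[ xs ] f ≡ 0
ΣN-zero []       _    = refl
ΣN-zero (x ∷ xs) f≡0 = cong₂ ℕ._+_ (f≡0 (here refl)) (ΣN-zero xs (f≡0 ∘ there))

ΣN-single : ∀ {A : Set} {xs : List A} {c} (f : A → ℕ) → Unique xs → c ∈ xs →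
            (∀ {x} → x ∈ xs → x ≢ c → f x ≡ 0) → ΣN[ xs ] f ≡ f c
ΣN-single {xs = c ∷ xs} f (c∉xs ∷ _) (here refl) f≡0 = begin
  f c ℕ.+ ΣN[ xs ] f  ≡⟨ cong (f c ℕ.+_) (ΣN-zero xs (λ x∈ → f≡0 (there x∈) (All.lookup c∉xs x∈ ∘ ≡.sym))) ⟩
  f c ℕ.+ 0           ≡⟨ ℕₚ.+-identityʳ (f c) ⟩
  f c                 ∎
ΣN-single f (x∉xs ∷ xs!) (there c∈) f≡0 =
  cong₂ ℕ._+_ (f≡0 (here refl) (All.lookup x∉xs c∈)) (ΣN-single f xs! c∈ (f≡0 ∘ there))

allSubsets-complete : ∀ n (x : Subset n) → x ∈ allSubsets n
allSubsets-complete zero    []          = here refl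
allSubsets-complete (suc n) (false ∷ x) = ∈ₚ.∈-++⁺ˡ (∈ₚ.∈-map⁺ (outside ∷_) (allSubsets-complete n x))
allSubsets-complete (suc n) (true ∷ x)  =
  ∈ₚ.∈-++⁺ʳ (map (outside ∷_) (allSubsets n)) (∈ₚ.∈-map⁺ (inside ∷_) (allSubsets-complete n x))

allSubsets-unique : ∀ n → Unique (allSubsets n)
allSubsets-unique zero    = All.[] ∷ []
allSubsets-unique (suc n) = Uniqueₚ.++⁺ (Uniqueₚ.map⁺ ∷-injectiveʳ (allSubsets-unique n))
                                        (Uniqueₚ.map⁺ ∷-injectiveʳ (allSubsets-unique n))
                                        outside∉inside
  where
  ∷-injectiveʳ : ∀ {b c} {x y : Subset n} → b ∷ x ≡ c ∷ y → x ≡ y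
  ∷-injectiveʳ refl = refl
  outside∉inside : ∀ {z} → z ∈ map (outside ∷_) (allSubsets n) × z ∈ map (inside ∷_) (allSubsets n) → ⊥
  outside∉inside (z∈ , z∈′) with ∈ₚ.∈-map⁻ (outside ∷_) z∈ | ∈ₚ.∈-map⁻ (inside ∷_) z∈′
  ... | _ , _ , refl | _ , _ , ()

verts-unique : ∀ n k → Unique (verts n k)
verts-unique n k = Uniqueₚ.filter⁺ (λ x → ∣ x ∣ ℕ.≟ k) (allSubsets-unique n)

∈-verts⁺ : ∀ {n k} {x : Subset n} → IsVertex n k x → x ∈ verts n k
∈-verts⁺ {n} {k} {x} = ∈ₚ.∈-filter⁺ (λ x → ∣ x ∣ ℕ.≟ k) (allSubsets-complete n x)

∈-verts⁻ : ∀ {n k} {x : Subset n} → x ∈ verts n k → IsVertex n k x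
∈-verts⁻ {n} {k} = proj₂ ∘ ∈ₚ.∈-filter⁻ (λ x → ∣ x ∣ ℕ.≟ k) {xs = allSubsets n}

lookup-ext : ∀ {A : Set} {n} {x y : Vec A n} → lookup x ≗ lookup y → x ≡ y
lookup-ext {x = x} {y} x≗y = begin
  x                   ≡⟨ Vecₚ.tabulate∘lookup x ⟨
  tabulate (lookup x) ≡⟨ Vecₚ.tabulate-cong x≗y ⟩
  tabulate (lookup y) ≡⟨ Vecₚ.tabulate∘lookup y ⟩
  y                   ∎

∣p∣≡sum-lookup : ∀ {n} (p : Subset n) → ∣ p ∣ ≡ sum (bℕ ∘ lookup p)
∣p∣≡sum-lookup []          = refl
∣p∣≡sum-lookup (true ∷ p)  = cong suc (∣p∣≡sum-lookup p)
∣p∣≡sum-lookup (false ∷ p) = ∣p∣≡sum-lookup p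

∁-involutive : ∀ {n} (p : Subset n) → ∁ (∁ p) ≡ p
∁-involutive p = begin
  ∁ (∁ p)               ≡⟨ Vecₚ.map-∘ not not p ⟨
  Vec.map (not ∘ not) p ≡⟨ Vecₚ.map-cong Boolₚ.not-involutive p ⟩
  Vec.map id p          ≡⟨ Vecₚ.map-id p ⟩
  p                     ∎

∁p≢p : ∀ {n} (p : Subset (suc n)) → ∁ p ≢ p
∁p≢p (true  ∷ _) ()
∁p≢p (false ∷ _) ()

∣⊤++∅∣ : ∀ k m → ∣ ⊤ {k} Vec.++ ∅ {m} ∣ ≡ k
∣⊤++∅∣ zero    m = Subsetₚ.∣⊥∣≡0 m
∣⊤++∅∣ (suc k) m = cong suc (∣⊤++∅∣ k m)

disjoint⇒∣p∣+∣q∣≤n : ∀ {n} (p q : Subset n) → ∣ p ∩ q ∣ ≡ 0 → ∣ p ∣ ℕ.+ ∣ q ∣ ≤ n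
disjoint⇒∣p∣+∣q∣≤n []          []          _     = ℕ.z≤n
disjoint⇒∣p∣+∣q∣≤n (true ∷ p)  (false ∷ q) p∩q≡0 = ℕ.s≤s (disjoint⇒∣p∣+∣q∣≤n p q p∩q≡0)
disjoint⇒∣p∣+∣q∣≤n {suc n} (false ∷ p) (true ∷ q) p∩q≡0 =
  subst (_≤ suc n) (≡.sym (ℕₚ.+-suc ∣ p ∣ ∣ q ∣)) (ℕ.s≤s (disjoint⇒∣p∣+∣q∣≤n p q p∩q≡0))
disjoint⇒∣p∣+∣q∣≤n (false ∷ p) (false ∷ q) p∩q≡0 = ℕₚ.m≤n⇒m≤1+n (disjoint⇒∣p∣+∣q∣≤n p q p∩q≡0)

disjoint⇒complement : ∀ {n} (p q : Subset n) → ∣ p ∩ q ∣ ≡ 0 → ∣ p ∣ ℕ.+ ∣ q ∣ ≡ n → q ≡ ∁ p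
disjoint⇒complement []          []          _     _ = refl
disjoint⇒complement (true ∷ p)  (false ∷ q) p∩q≡0 ∣p∣+∣q∣≡n =
  cong (false ∷_) (disjoint⇒complement p q p∩q≡0 (ℕₚ.suc-injective ∣p∣+∣q∣≡n))
disjoint⇒complement (false ∷ p) (true ∷ q)  p∩q≡0 ∣p∣+∣q∣≡n =
  cong (true ∷_) (disjoint⇒complement p q p∩q≡0
                    (ℕₚ.suc-injective (trans (≡.sym (ℕₚ.+-suc ∣ p ∣ ∣ q ∣)) ∣p∣+∣q∣≡n)))
disjoint⇒complement {suc n} (false ∷ p) (false ∷ q) p∩q≡0 ∣p∣+∣q∣≡n =
  ⊥-elim (ℕₚ.1+n≰n (subst (_≤ n) ∣p∣+∣q∣≡n (disjoint⇒∣p∣+∣q∣≤n p q p∩q≡0)))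

∃-∉-∈ : ∀ {n} (u v : Subset n) → ∣ u ∣ ≤ ∣ v ∣ → u ≢ v →
        ∃ λ a → lookup u a ≡ false × lookup v a ≡ true
∃-∉-∈ []          []          _       u≢v = ⊥-elim (u≢v refl)
∃-∉-∈ (false ∷ u) (true ∷ v)  _       _   = Fin.zero , refl , refl
∃-∉-∈ (true ∷ u)  (false ∷ v) ∣u∣<∣v∣ _   =
  Product.map Fin.suc id (∃-∉-∈ u v (ℕₚ.<⇒≤ ∣u∣<∣v∣) λ { refl → ℕₚ.<-irrefl refl ∣u∣<∣v∣ })
∃-∉-∈ (true ∷ u)  (true ∷ v)  ∣u∣≤∣v∣ u≢v =
  Product.map Fin.suc id (∃-∉-∈ u v (ℕ.s≤s⁻¹ ∣u∣≤∣v∣) (u≢v ∘ cong (true ∷_)))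
∃-∉-∈ (false ∷ u) (false ∷ v) ∣u∣≤∣v∣ u≢v =
  Product.map Fin.suc id (∃-∉-∈ u v ∣u∣≤∣v∣ (u≢v ∘ cong (false ∷_)))

∃-∉-∉ : ∀ {n} (u v : Subset n) → ∣ u ∣ ℕ.+ ∣ v ∣ < n →
        ∃ λ b → lookup u b ≡ false × lookup v b ≡ false
∃-∉-∉ (false ∷ u) (false ∷ v) _ = Fin.zero , refl , refl
∃-∉-∉ (true ∷ u)  (b ∷ v)     ∣u∣+∣v∣<n = Product.map Fin.suc id (∃-∉-∉ u v
  (ℕₚ.≤-<-trans (ℕₚ.+-monoʳ-≤ ∣ u ∣ (Subsetₚ.∣p∣≤∣x∷p∣ b v)) (ℕ.s≤s⁻¹ ∣u∣+∣v∣<n)))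
∃-∉-∉ {suc n} (false ∷ u) (true ∷ v) ∣u∣+∣v∣<n = Product.map Fin.suc id (∃-∉-∉ u v
  (ℕ.s≤s⁻¹ (subst (_< suc n) (ℕₚ.+-suc ∣ u ∣ ∣ v ∣) ∣u∣+∣v∣<n)))

-- Permutations of the ground set acting on subsets

permute : ∀ {n} → Permutation n n → Subset n → Subset n
permute π p = tabulate (λ i → lookup p (π ⟨$⟩ʳ i))

lookup-permute : ∀ {n} (π : Permutation n n) p i → lookup (permute π p) i ≡ lookup p (π ⟨$⟩ʳ i)
lookup-permute π p = Vecₚ.lookup∘tabulate _

permute-flip : ∀ {n} (π : Permutation n n) p → permute π (permute (flip π) p) ≡ p
permute-flip π p = lookup-ext λ i → begin
  lookup (permute π (permute (flip π) p)) i  ≡⟨ lookup-permute π (permute (flip π) p) i ⟩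
  lookup (permute (flip π) p) (π ⟨$⟩ʳ i)     ≡⟨ lookup-permute (flip π) p _ ⟩
  lookup p (flip π ⟨$⟩ʳ (π ⟨$⟩ʳ i))           ≡⟨ cong (lookup p) (inverseˡ π) ⟩
  lookup p i                                 ∎

permute-∩ : ∀ {n} (π : Permutation n n) p q → permute π (p ∩ q) ≡ permute π p ∩ permute π q
permute-∩ π p q = lookup-ext λ i → begin
  lookup (permute π (p ∩ q)) i
    ≡⟨ lookup-permute π (p ∩ q) i ⟩
  lookup (p ∩ q) (π ⟨$⟩ʳ i)
    ≡⟨ Vecₚ.lookup-zipWith _∧_ _ p q ⟩
  lookup p (π ⟨$⟩ʳ i) ∧ lookup q (π ⟨$⟩ʳ i)
    ≡⟨ cong₂ _∧_ (lookup-permute π p i) (lookup-permute π q i) ⟨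
  lookup (permute π p) i ∧ lookup (permute π q) i
    ≡⟨ Vecₚ.lookup-zipWith _∧_ i (permute π p) (permute π q) ⟨
  lookup (permute π p ∩ permute π q) i
    ∎

∣permute∣ : ∀ {n} (π : Permutation n n) p → ∣ permute π p ∣ ≡ ∣ p ∣
∣permute∣ π p = begin
  ∣ permute π p ∣                      ≡⟨ ∣p∣≡sum-lookup (permute π p) ⟩
  sum (bℕ ∘ lookup (permute π p))      ≡⟨ sum-cong-≗ (cong bℕ ∘ lookup-permute π p) ⟩
  sum (λ i → bℕ (lookup p (π ⟨$⟩ʳ i))) ≡⟨ sum-permute (bℕ ∘ lookup p) π ⟨
  sum (bℕ ∘ lookup p)                  ≡⟨ ∣p∣≡sum-lookup p ⟨
  ∣ p ∣                                ∎

Aᴶ-permute : ∀ {n k} (π : Permutation n n) i x y → Aᴶ n k i (permute π x) (permute π y) ≡ Aᴶ n k i x y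
Aᴶ-permute {k = k} π i x y = cong (λ m → ⌊ m ℕ.+ toℕ i ℕ.≟ k ⌋)
  (trans (cong ∣_∣ (≡.sym (permute-∩ π x y))) (∣permute∣ π (x ∩ y)))

BelongsToScheme⇒permute-adj : ∀ {n k} {G : Graph n k} → BelongsToScheme G → (π : Permutation n n) →
  ∀ x y → IsVertex n k x → IsVertex n k y → adj G (permute π x) (permute π y) ≡ adj G x y
BelongsToScheme⇒permute-adj {n} {k} {G} (c , G≡ΣcA) π x y x∈ y∈ = bℚ-injective (begin
  bℚ (adj G (permute π x) (permute π y))
    ≡⟨ G≡ΣcA _ _ (trans (∣permute∣ π x) x∈) (trans (∣permute∣ π y) y∈) ⟩
  Σ[ allFin (suc k) ] (λ i → c i ℚ.* bℚ (Aᴶ n k i (permute π x) (permute π y)))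
    ≡⟨ Σ-cong (allFin (suc k)) (λ i → cong (λ b → c i ℚ.* bℚ b) (Aᴶ-permute π i x y)) ⟩
  Σ[ allFin (suc k) ] (λ i → c i ℚ.* bℚ (Aᴶ n k i x y))
    ≡⟨ G≡ΣcA x y x∈ y∈ ⟨
  bℚ (adj G x y) ∎)

transpose-fixes : ∀ {n} (p : Subset n) {a b} → lookup p a ≡ lookup p b → permute (transpose a b) p ≡ p
transpose-fixes p {a} {b} pa≡pb = lookup-ext λ i → trans (lookup-permute (transpose a b) p i) (swapped i)
  where
  swapped : ∀ i → lookup p (PC.transpose a b i) ≡ lookup p i
  swapped i with i Fin.≟ a
  ... | yes refl = ≡.sym pa≡pb
  ... | no _ with i Fin.≟ b
  ...   | yes refl = pa≡pb
  ...   | no _     = refl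

transpose-moves : ∀ {n} (p : Subset n) {a b} → lookup p a ≢ lookup p b → permute (transpose a b) p ≢ p
transpose-moves p {a} {b} pa≢pb πp≡p = pa≢pb (begin
  lookup p a                           ≡⟨ cong (λ q → lookup q a) πp≡p ⟨
  lookup (permute (transpose a b) p) a ≡⟨ lookup-permute (transpose a b) p a ⟩
  lookup p (PC.transpose a b a)        ≡⟨ cong (lookup p) transpose-a≡b ⟩
  lookup p b                           ∎)
  where
  transpose-a≡b : PC.transpose a b a ≡ b
  transpose-a≡b rewrite dec-true (a Fin.≟ a) refl = refl

∃-permutation-fixing-moving : ∀ {n k} (u v : Subset n) → IsVertex n k u → IsVertex n k v → u ≢ v →
                              2 * k < n → ∃ λ (π : Permutation n n) → permute π u ≡ u × permute π v ≢ v
∃-permutation-fixing-moving {n} {k} u v u∈ v∈ u≢v 2k<n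
  with a , ua , va ← ∃-∉-∈ u v (ℕₚ.≤-reflexive (trans u∈ (≡.sym v∈))) u≢v
     | b , ub , vb ← ∃-∉-∉ u v (subst (_< n) (≡.sym (trans (cong₂ ℕ._+_ u∈ v∈) (n+n≡2*n k))) 2k<n)
  = transpose a b
  , transpose-fixes u (trans ua (≡.sym ub))
  , transpose-moves v (subst₂ _≢_ (≡.sym va) (≡.sym vb) λ ())

neighbours : ∀ {n k} → Graph n k → Subset n → List (Subset n)
neighbours {n} {k} G x = filter (λ y → adj G x y Boolₚ.≟ true) (verts n k)

module _ {n k : ℕ} (G : Graph n k) where

  private
    adjacent? : ∀ a → Dec (adj G (proj₁ a) (proj₂ a) ≡ true)
    adjacent? a = adj G (proj₁ a) (proj₂ a) Boolₚ.≟ true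

  ∈-neighbours⁺ : ∀ {x y} → IsVertex n k y → adj G x y ≡ true → y ∈ neighbours G x
  ∈-neighbours⁺ {x} y∈ = ∈ₚ.∈-filter⁺ (λ y → adj G x y Boolₚ.≟ true) (∈-verts⁺ y∈)

  ∈-neighbours⁻ : ∀ {x y} → y ∈ neighbours G x → IsVertex n k y × adj G x y ≡ true
  ∈-neighbours⁻ {x} y∈ with y∈V , xy ← ∈ₚ.∈-filter⁻ (λ y → adj G x y Boolₚ.≟ true) {xs = verts n k} y∈
    = ∈-verts⁻ y∈V , xy

  neighbours-unique : ∀ x → Unique (neighbours G x)
  neighbours-unique x = Uniqueₚ.filter⁺ (λ y → adj G x y Boolₚ.≟ true) (verts-unique n k)

  ∃-arc-into : ∀ {v} → IsVertex n k v → 1 ≤ deg G v → ∃ λ w → IsArc G (w , v)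
  ∃-arc-into {v} v∈ deg≥1 with w , w∈ ← ∈-nonempty (neighbours G v) deg≥1
                          with w∈V , vw ← ∈-neighbours⁻ w∈
    = w , w∈V , v∈ , trans (Graph.sym G w v w∈V v∈) vw

  arcs≡filter-cartesianProduct : arcs G ≡ filter adjacent? (cartesianProduct (verts n k) (verts n k))
  arcs≡filter-cartesianProduct =
    cong (filter adjacent?) (concatMap-pairs≡cartesianProduct (verts n k) (verts n k))

  arcs-unique : Unique (arcs G)
  arcs-unique = subst Unique (≡.sym arcs≡filter-cartesianProduct)
    (Uniqueₚ.filter⁺ adjacent? (Uniqueₚ.cartesianProduct⁺ (verts-unique n k) (verts-unique n k)))

  ∈-arcs⁺ : ∀ {a} → IsArc G a → a ∈ arcs G
  ∈-arcs⁺ (u∈ , v∈ , uv) = subst (_ ∈_) (≡.sym arcs≡filter-cartesianProduct)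
    (∈ₚ.∈-filter⁺ adjacent? (∈ₚ.∈-cartesianProduct⁺ (∈-verts⁺ u∈) (∈-verts⁺ v∈)) uv)

  ∈-arcs⁻ : ∀ {a} → a ∈ arcs G → IsArc G a
  ∈-arcs⁻ a∈ with a∈V² , uv ← ∈ₚ.∈-filter⁻ adjacent? (subst (_ ∈_) arcs≡filter-cartesianProduct a∈)
             with u∈ , v∈ ← ∈ₚ.∈-cartesianProduct⁻ (verts n k) (verts n k) a∈V²
    = ∈-verts⁻ u∈ , ∈-verts⁻ v∈ , uv

-- Equivariance of the Grover walk

module Equivariance {n k : ℕ} (G : Graph n k) (π : Permutation n n)
  (π-adj : ∀ x y → IsVertex n k x → IsVertex n k y → adj G (permute π x) (permute π y) ≡ adj G x y)
  where

  σ σ⁻¹ : Subset n → Subset n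
  σ   = permute π
  σ⁻¹ = permute (flip π)

  σ̂ σ̂⁻¹ : Arc n → Arc n
  σ̂   (u , v) = σ u , σ v
  σ̂⁻¹ (u , v) = σ⁻¹ u , σ⁻¹ v

  σ-vertex : ∀ x → IsVertex n k x → IsVertex n k (σ x)
  σ-vertex x = trans (∣permute∣ π x)

  σ⁻¹-vertex : ∀ x → IsVertex n k x → IsVertex n k (σ⁻¹ x)
  σ⁻¹-vertex x = trans (∣permute∣ (flip π) x)

  σ⁻¹-adj : ∀ x y → IsVertex n k x → IsVertex n k y → adj G (σ⁻¹ x) (σ⁻¹ y) ≡ adj G x y
  σ⁻¹-adj x y x∈ y∈ = trans (≡.sym (π-adj (σ⁻¹ x) (σ⁻¹ y) (σ⁻¹-vertex x x∈) (σ⁻¹-vertex y y∈)))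
                            (cong₂ (adj G) (permute-flip π x) (permute-flip π y))

  ==ₛ-σ : ∀ x y → (σ x ==ₛ σ y) ≡ (x ==ₛ y)
  ==ₛ-σ = injective⇒==ₛ-preserved λ {x} {y} σx≡σy →
    trans (≡.sym (permute-flip (flip π) x)) (trans (cong σ⁻¹ σx≡σy) (permute-flip (flip π) y))

  σ̂-arc : ∀ {a} → IsArc G a → IsArc G (σ̂ a)
  σ̂-arc {u , v} (u∈ , v∈ , uv) = σ-vertex u u∈ , σ-vertex v v∈ , trans (π-adj u v u∈ v∈) uv

  σ̂⁻¹-arc : ∀ {a} → IsArc G a → IsArc G (σ̂⁻¹ a)
  σ̂⁻¹-arc {u , v} (u∈ , v∈ , uv) = σ⁻¹-vertex u u∈ , σ⁻¹-vertex v v∈ , trans (σ⁻¹-adj u v u∈ v∈) uv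

  verts-↭ : map σ (verts n k) ↭ verts n k
  verts-↭ = map-↭ {g = σ⁻¹} (permute-flip (flip π)) (permute-flip π) (verts-unique n k) (verts-unique n k)
    (λ {x} x∈ → ∈-verts⁺ (σ-vertex x (∈-verts⁻ x∈))) (λ {x} x∈ → ∈-verts⁺ (σ⁻¹-vertex x (∈-verts⁻ x∈)))

  arcs-↭ : map σ̂ (arcs G) ↭ arcs G
  arcs-↭ = map-↭ {g = σ̂⁻¹} (λ (u , v) → cong₂ _,_ (permute-flip (flip π) u) (permute-flip (flip π) v))
                 (λ (u , v) → cong₂ _,_ (permute-flip π u) (permute-flip π v))
                 (arcs-unique G) (arcs-unique G)
                 (∈-arcs⁺ G ∘ σ̂-arc ∘ ∈-arcs⁻ G) (∈-arcs⁺ G ∘ σ̂⁻¹-arc ∘ ∈-arcs⁻ G)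

  neighbours-↭ : ∀ x → IsVertex n k x → map σ (neighbours G x) ↭ neighbours G (σ x)
  neighbours-↭ x x∈ = map-↭ {g = σ⁻¹} (permute-flip (flip π)) (permute-flip π)
    (neighbours-unique G x) (neighbours-unique G (σ x)) σ-neighbour σ⁻¹-neighbour
    where
    σ-neighbour : ∀ {y} → y ∈ neighbours G x → σ y ∈ neighbours G (σ x)
    σ-neighbour {y} y∈ with y∈V , xy ← ∈-neighbours⁻ G y∈ =
      ∈-neighbours⁺ G (σ-vertex y y∈V) (trans (π-adj x y x∈ y∈V) xy)
    σ⁻¹-neighbour : ∀ {y} → y ∈ neighbours G (σ x) → σ⁻¹ y ∈ neighbours G x
    σ⁻¹-neighbour {y} y∈ with y∈V , σxy ← ∈-neighbours⁻ G y∈ =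
      ∈-neighbours⁺ G (σ⁻¹-vertex y y∈V)
        (trans (cong (λ z → adj G z (σ⁻¹ y)) (≡.sym (permute-flip (flip π) x)))
               (trans (σ⁻¹-adj (σ x) y (σ-vertex x x∈) y∈V) σxy))

  deg-σ : ∀ x → IsVertex n k x → deg G (σ x) ≡ deg G x
  deg-σ x x∈ = trans (≡.sym (↭ₚ.↭-length (neighbours-↭ x x∈))) (length-map σ (neighbours G x))

  shift-σ : ∀ {ψ ψ′} → ψ ∘ σ̂ ≗ ψ′ → shift G ψ ∘ σ̂ ≗ shift G ψ′
  shift-σ {ψ} {ψ′} ψσ≗ψ′ (u , v) = begin
    shift G ψ (σ u , σ v)
      ≡⟨ Σ-reindex arcs-↭ (λ b → bℚ ((σ u ==ₛ proj₂ b) ∧ (σ v ==ₛ proj₁ b)) ℚ.* ψ b) ⟩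
    Σ[ arcs G ] (λ b → bℚ ((σ u ==ₛ σ (proj₂ b)) ∧ (σ v ==ₛ σ (proj₁ b))) ℚ.* ψ (σ̂ b))
      ≡⟨ Σ-cong (arcs G) (λ b → cong₂ (λ e r → bℚ e ℚ.* r)
           (cong₂ _∧_ (==ₛ-σ u (proj₂ b)) (==ₛ-σ v (proj₁ b))) (ψσ≗ψ′ b)) ⟩
    shift G ψ′ (u , v)
      ∎

  NstarN-σ : ∀ {ψ ψ′} → ψ ∘ σ̂ ≗ ψ′ → NstarN G ψ ∘ σ̂ ≗ NstarN G ψ′
  NstarN-σ {ψ} {ψ′} ψσ≗ψ′ a = begin
    NstarN G ψ (σ̂ a)
      ≡⟨ Σ-reindex arcs-↭ (λ b → head-weight (σ̂ a) b ℚ.* ψ b) ⟩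
    Σ[ arcs G ] (λ b → head-weight (σ̂ a) (σ̂ b) ℚ.* ψ (σ̂ b))
      ≡⟨ Σ-cong (arcs G) (λ b → cong₂ ℚ._*_ (head-weight-σ b) (ψσ≗ψ′ b)) ⟩
    NstarN G ψ′ a
      ∎
    where
    head-weight : Arc n → Arc n → ℚ
    head-weight a b = Σ[ verts n k ] (λ u → inv (deg G u) ℚ.* bℚ (u ==ₛ t a) ℚ.* bℚ (u ==ₛ t b))
    σ-weight : Arc n → Arc n → Subset n → ℚ
    σ-weight a b u = inv (deg G u) ℚ.* bℚ (u ==ₛ σ (t a)) ℚ.* bℚ (u ==ₛ σ (t b))
    head-weight-σ : ∀ b → head-weight (σ̂ a) (σ̂ b) ≡ head-weight a b
    head-weight-σ b = trans (Σ-reindex verts-↭ (σ-weight a b)) (Σ-cong-∈ (verts n k) λ {u} u∈ →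
      cong₂ ℚ._*_ (cong₂ (λ d e → inv d ℚ.* bℚ e) (deg-σ u (∈-verts⁻ u∈)) (==ₛ-σ u (t a)))
                  (cong bℚ (==ₛ-σ u (t b))))

  coin-σ : ∀ {ψ ψ′} → ψ ∘ σ̂ ≗ ψ′ → coin G ψ ∘ σ̂ ≗ coin G ψ′
  coin-σ ψσ≗ψ′ a = cong₂ (λ r s → toℚ 2 ℚ.* r ℚ.- s) (NstarN-σ ψσ≗ψ′ a) (ψσ≗ψ′ a)

  Uᵗ-σ : ∀ τ {ψ ψ′} → ψ ∘ σ̂ ≗ ψ′ → Uᵗ G τ ψ ∘ σ̂ ≗ Uᵗ G τ ψ′
  Uᵗ-σ zero    ψσ≗ψ′ = ψσ≗ψ′
  Uᵗ-σ (suc τ) ψσ≗ψ′ = shift-σ (coin-σ (Uᵗ-σ τ ψσ≗ψ′))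

  χ-σ : ∀ {u} → σ u ≡ u → χ u ∘ σ̂ ≗ χ u
  χ-σ {u} σu≡u (_ , v) = cong bℚ (trans (cong (_==ₛ σ v) (≡.sym σu≡u)) (==ₛ-σ u v))

  transfer-amplitude≡0 : ∀ {u v τ q} → σ u ≡ u → σ v ≢ v → IsVertex n k v → 1 ≤ deg G v →
                         (∀ a → IsArc G a → Uᵗ G τ (χ u) a ≡ q ℚ.* χ v a) → q ≡ 0ℚ
  transfer-amplitude≡0 {u} {v} {τ} {q} σu≡u σv≢v v∈ deg-v≥1 transfer
    with w , wv-arc ← ∃-arc-into G {v} v∈ deg-v≥1 = begin
    q                          ≡⟨ ℚₚ.*-identityʳ q ⟨
    q ℚ.* bℚ true              ≡⟨ cong (λ b → q ℚ.* bℚ b) (==ₛ-true {x = v} refl) ⟨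
    q ℚ.* χ v (w , v)          ≡⟨ transfer (w , v) wv-arc ⟨
    Uᵗ G τ (χ u) (w , v)       ≡⟨ Uᵗ-σ τ (χ-σ σu≡u) (w , v) ⟨
    Uᵗ G τ (χ u) (σ̂ (w , v))   ≡⟨ transfer (σ̂ (w , v)) (σ̂-arc wv-arc) ⟩
    q ℚ.* χ v (σ̂ (w , v))      ≡⟨ cong (λ b → q ℚ.* bℚ b) (==ₛ-false (σv≢v ∘ ≡.sym)) ⟩
    q ℚ.* 0ℚ                   ≡⟨ ℚₚ.*-zeroʳ q ⟩
    0ℚ                         ∎

¬PST-if-2k<n : ∀ {n k} → 2 * k < n → (G : Graph n k) → BelongsToScheme G → NoIsolatedVertices G → ¬ PST G
¬PST-if-2k<n {k = k} 2k<n G G∈J no-isolated (u , v , u∈ , v∈ , u≢v , τ , _ , q , q²dv≡du , transfer) =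
  ℕₚ.1+n≰n (subst (1 ≤_) deg-u≡0 (no-isolated u u∈))
  where
  q≡0 : q ≡ 0ℚ
  q≡0 = let π , πu≡u , πv≢v = ∃-permutation-fixing-moving {k = k} u v u∈ v∈ u≢v 2k<n in
    Equivariance.transfer-amplitude≡0 G π (BelongsToScheme⇒permute-adj {G = G} G∈J π) {u} {v} {τ}
      πu≡u πv≢v v∈ (no-isolated v v∈) transfer
  deg-u≡0 : deg G u ≡ 0
  deg-u≡0 = toℚ≡0⇒≡0 (deg G u) (begin
    toℚ (deg G u)                ≡⟨ q²dv≡du ⟨
    q ℚ.* q ℚ.* toℚ (deg G v)    ≡⟨ cong (λ r → r ℚ.* r ℚ.* toℚ (deg G v)) q≡0 ⟩
    0ℚ ℚ.* 0ℚ ℚ.* toℚ (deg G v)  ≡⟨ ℚₚ.*-zeroˡ (toℚ (deg G v)) ⟩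
    0ℚ                           ∎)

PST⇒n≡2k : ∀ {n k} → 2 * k ≤ n → (G : Graph n k) → BelongsToScheme G → NoIsolatedVertices G →
           PST G → n ≡ 2 * k
PST⇒n≡2k {n} {k} 2k≤n G G∈J no-isolated pst with n ℕ.≟ 2 * k
... | yes n≡2k = n≡2k
... | no  n≢2k = ⊥-elim (¬PST-if-2k<n (ℕₚ.≤∧≢⇒< 2k≤n (n≢2k ∘ ≡.sym)) G G∈J no-isolated pst)

-- Permutation matrices of fixed-point-free involutions

module _ {n k : ℕ} (M : Mat n) (π : Subset n → Subset n)
  (π-vertex : ∀ x → IsVertex n k x → IsVertex n k (π x))
  (π-involutive : ∀ x → π (π x) ≡ x)
  (π-fixedPointFree : ∀ x → π x ≢ x)
  (M≡graph-π : ∀ x y → IsVertex n k x → IsVertex n k y → M x y ≡ bℕ (π x ==ₛ y))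
  where

  private
    ΣN-verts-single : ∀ (f : Subset n → ℕ) c → IsVertex n k c →
                      (∀ x → IsVertex n k x → x ≢ c → f x ≡ 0) → ΣN[ verts n k ] f ≡ f c
    ΣN-verts-single f c c∈ f≡0 =
      ΣN-single f (verts-unique n k) (∈-verts⁺ c∈) (λ {x} x∈ → f≡0 x (∈-verts⁻ x∈))

    M-on-graph : ∀ x → IsVertex n k x → M x (π x) ≡ 1
    M-on-graph x x∈ = trans (M≡graph-π x (π x) x∈ (π-vertex x x∈)) (cong bℕ (==ₛ-true {x = π x} refl))

    M-off-graph : ∀ x y → IsVertex n k x → IsVertex n k y → y ≢ π x → M x y ≡ 0
    M-off-graph x y x∈ y∈ y≢πx = trans (M≡graph-π x y x∈ y∈) (cong bℕ (==ₛ-false (y≢πx ∘ ≡.sym)))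

  permutationMatrix-isFixedPointFreeInvolution : ∀ x₀ → IsVertex n k x₀ →
                                                 IsFixedPointFreeInvolution n k M
  permutationMatrix-isFixedPointFreeInvolution x₀ x₀∈ =
    (entries , rows , columns) , involutive , not-identity , diagonal
    where
    entries : ∀ x y → IsVertex n k x → IsVertex n k y → M x y ≡ 0 ⊎ M x y ≡ 1
    entries x y x∈ y∈ = subst (λ m → m ≡ 0 ⊎ m ≡ 1) (≡.sym (M≡graph-π x y x∈ y∈)) (bℕ-0∨1 _)

    rows : ∀ x → IsVertex n k x → ΣN[ verts n k ] (M x) ≡ 1
    rows x x∈ = trans (ΣN-verts-single (M x) (π x) (π-vertex x x∈) (λ y y∈ → M-off-graph x y x∈ y∈))
                      (M-on-graph x x∈)

    columns : ∀ y → IsVertex n k y → ΣN[ verts n k ] (λ x → M x y) ≡ 1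
    columns y y∈ = begin
      ΣN[ verts n k ] (λ x → M x y) ≡⟨ ΣN-verts-single (λ x → M x y) (π y) (π-vertex y y∈) off-graph ⟩
      M (π y) y                     ≡⟨ M≡graph-π (π y) y (π-vertex y y∈) y∈ ⟩
      bℕ (π (π y) ==ₛ y)            ≡⟨ cong bℕ (==ₛ-true (π-involutive y)) ⟩
      1                             ∎
      where
      off-graph : ∀ x → IsVertex n k x → x ≢ π y → M x y ≡ 0
      off-graph x x∈ x≢πy = M-off-graph x y x∈ y∈ λ y≡πx →
        x≢πy (trans (≡.sym (π-involutive x)) (cong π (≡.sym y≡πx)))

    involutive : ∀ x z → IsVertex n k x → IsVertex n k z → (k ·ₘ M) M x z ≡ IdM x z
    involutive x z x∈ z∈ = begin
      (k ·ₘ M) M x z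
        ≡⟨ ΣN-verts-single (λ y → M x y ℕ.* M y z) (π x) (π-vertex x x∈)
             (λ y y∈ y≢πx → cong (ℕ._* M y z) (M-off-graph x y x∈ y∈ y≢πx)) ⟩
      M x (π x) ℕ.* M (π x) z
        ≡⟨ cong₂ ℕ._*_ (M-on-graph x x∈) (M≡graph-π (π x) z (π-vertex x x∈) z∈) ⟩
      1 ℕ.* bℕ (π (π x) ==ₛ z)
        ≡⟨ ℕₚ.*-identityˡ _ ⟩
      bℕ (π (π x) ==ₛ z)
        ≡⟨ cong (λ w → bℕ (w ==ₛ z)) (π-involutive x) ⟩
      IdM x z
        ∎

    diagonal : ∀ x → IsVertex n k x → M x x ≡ 0
    diagonal x x∈ = trans (M≡graph-π x x x∈ x∈) (cong bℕ (==ₛ-false (π-fixedPointFree x)))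

    not-identity : ¬ (∀ x y → IsVertex n k x → IsVertex n k y → M x y ≡ IdM x y)
    not-identity M≡I = ℕₚ.0≢1+n (begin
      0         ≡⟨ diagonal x₀ x₀∈ ⟨
      M x₀ x₀   ≡⟨ M≡I x₀ x₀ x₀∈ x₀∈ ⟩
      IdM x₀ x₀ ≡⟨ cong bℕ (==ₛ-true {x = x₀} refl) ⟩
      1         ∎)

∁-vertex : ∀ k x → IsVertex (2 * k) k x → IsVertex (2 * k) k (∁ x)
∁-vertex k x x∈ = begin
  ∣ ∁ x ∣          ≡⟨ Subsetₚ.∣∁p∣≡n∸∣p∣ x ⟩
  2 * k ℕ.∸ ∣ x ∣  ≡⟨ cong₂ ℕ._∸_ (n+n≡2*n k) (≡.sym x∈) ⟨
  k ℕ.+ k ℕ.∸ k    ≡⟨ ℕₚ.m+n∸n≡m k k ⟩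
  k                ∎

Aᴶ-fromℕ≡complement : ∀ k x y → IsVertex (2 * k) k x → IsVertex (2 * k) k y →
                      Aᴶℕ (2 * k) k (fromℕ k) x y ≡ bℕ (∁ x ==ₛ y)
Aᴶ-fromℕ≡complement k x y x∈ y∈ = cong bℕ (⌊⌋-⇔ (mk⇔ disjoint⇒∁ ∁⇒disjoint) _ (∁ x ≟ₛ y))
  where
  disjoint⇒∁ : ∣ x ∩ y ∣ ℕ.+ toℕ (fromℕ k) ≡ k → ∁ x ≡ y
  disjoint⇒∁ ∣x∩y∣+k≡k =
    ≡.sym (disjoint⇒complement x y ∣x∩y∣≡0 (trans (cong₂ ℕ._+_ x∈ y∈) (n+n≡2*n k)))
    where
    ∣x∩y∣≡0 : ∣ x ∩ y ∣ ≡ 0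
    ∣x∩y∣≡0 = ℕₚ.+-cancelʳ-≡ k ∣ x ∩ y ∣ 0
      (trans (cong (∣ x ∩ y ∣ ℕ.+_) (≡.sym (Finₚ.toℕ-fromℕ k))) ∣x∩y∣+k≡k)
  ∁⇒disjoint : ∁ x ≡ y → ∣ x ∩ y ∣ ℕ.+ toℕ (fromℕ k) ≡ k
  ∁⇒disjoint refl = cong₂ ℕ._+_ (trans (cong ∣_∣ (Subsetₚ.∩-inverseʳ x)) (Subsetₚ.∣⊥∣≡0 (2 * k)))
                                (Finₚ.toℕ-fromℕ k)

Aᴶ-fromℕ-isFixedPointFreeInvolution : ∀ k → 1 ≤ k →
                                      IsFixedPointFreeInvolution (2 * k) k (Aᴶℕ (2 * k) k (fromℕ k))
Aᴶ-fromℕ-isFixedPointFreeInvolution k@(suc _) _ =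
  permutationMatrix-isFixedPointFreeInvolution (Aᴶℕ (2 * k) k (fromℕ k)) ∁
    (∁-vertex k) ∁-involutive ∁p≢p (Aᴶ-fromℕ≡complement k)
    (⊤ {k} Vec.++ ∅ {k ℕ.+ 0}) (∣⊤++∅∣ k (k ℕ.+ 0))

lemma3p12 :
    (∀ (n k : ℕ) → 1 ≤ k → 2 * k ≤ n →
      (G : Graph n k) → BelongsToScheme G → NoIsolatedVertices G →
      PST G → n ≡ 2 * k)
    ×
    (∀ (k : ℕ) → 1 ≤ k →
      IsFixedPointFreeInvolution (2 * k) k (Aᴶℕ (2 * k) k (fromℕ k)))
lemma3p12 = (λ n k _ → PST⇒n≡2k) , Aᴶ-fromℕ-isFixedPointFreeInvolution
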